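{- Let $k\geq 1$ and $n\geq 1$, and let $Q_k$ be the partially ordered pattern of size $k$ whose relations are $1>t$ for all $t\in\{2,\dots,k\}$. Let $A_n=(a_{ij})_{i,j\in[n]}$ be the binary $n\times n$ matrix with $a_{ij}=1$ if and only if $i\geq j-k+2$. Then an $n$-permutation $\pi$ avoids $Q_k$ if and only if $a_{i\,\pi_i}=1$ for all $i\in[n]$, i.e. if and only if $\pi_i\leq i+k-2$ for all $i\in[n]$.
   Context: A POP of size $k$ is a poset on $\{1,\dots,k\}$; an $n$-permutation $\pi$ contains it if there are indices $i_1<\cdots<i_k$ with $\pi_{i_a}<\pi_{i_b}$ whenever $a<b$ in the poset, and avoids it otherwise. So $\pi$ contains $Q_k$ iff some entry $\pi_{i_1}$ is larger than $k-1$ entries located to its right. $[n]=\{1,\dots,n\}$. -}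

module Defs where

open import Data.Nat using (ℕ; suc; _+_; _≤_; _<_; _≥_; _≤?_)
open import Data.Fin using (Fin; toℕ) renaming (_<_ to _<ᶠ_)
open import Data.Fin.Permutation using (Permutation′; _⟨$⟩ʳ_)
open import Data.Product using (Σ; _×_)
open import Relation.Nullary using (¬_; does)
open import Data.Bool using (Bool)
open import Relation.Binary.PropositionalEquality using (_≡_)

-- 1-based value of a 0-based index/entry
⟦_⟧ : ∀ {n} → Fin n → ℕ
⟦ i ⟧ = suc (toℕ i)

-- A partially ordered pattern (POP) of size k: a relation on positions Fin k
-- (position a ↔ 1-based label a+1); "a ≺ b" means element a is below b.
record POP (k : ℕ) : Set₁ where
  field
    _≺_ : Fin k → Fin k → Set

open POP

Contains : ∀ {n k} → Permutation′ n → POP k → Set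
Contains {n} {k} π P =
  Σ (Fin k → Fin n) λ ι →
    (∀ a b → a <ᶠ b → ι a <ᶠ ι b) ×
    (∀ a b → _≺_ P a b → (π ⟨$⟩ʳ ι a) <ᶠ (π ⟨$⟩ʳ ι b))

Avoids : ∀ {n k} → Permutation′ n → POP k → Set
Avoids π P = ¬ Contains π P

-- Q_k : relations 1 > t for t ∈ {2,…,k}, i.e. t ≺ 1 (in 1-based labels).
Q : (k : ℕ) → POP k
Q k = record { _≺_ = λ a b → (⟦ b ⟧ ≡ 1) × (2 ≤ ⟦ a ⟧) }

-- The binary matrix A_n (depending on k): a_ij = 1 iff i ≥ j - k + 2
-- (1-based i, j), written without truncated subtraction as i + k ≥ j + 2.
A : (k n : ℕ) → Fin n → Fin n → Bool
A k n i j = does (⟦ j ⟧ + 2 ≤? ⟦ i ⟧ + k)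

-- With 0-based positions and values and k = k′ + 1, π contains Q_k iff some entry π i exceeds k′
-- entries to its right, and the bound of the theorem reads π i < i + k′. If π i ≥ i + k′, then of
-- the π i positions holding smaller values at most i lie left of i, so at least k′ lie right of it.
-- Conversely, if π i exceeds the entries at k′ later positions, let m be the leftmost position with
-- π m ≥ π i; the m entries left of m and those k′ entries are all below π m, so π m ≥ m + k′.
module Submission where

open import Defs
open import Data.Nat using (ℕ; _+_; _≤_)
open import Data.Fin.Permutation using (Permutation′; _⟨$⟩ʳ_)
open import Data.Product using (_×_)
open import Data.Bool using (true)
open import Relation.Binary.PropositionalEquality using (_≡_)
open import Function.Bundles using (_⇔_)

open import Data.Nat using (zero; suc; z≤n; s≤s; s≤s⁻¹; _<_; _≤?_)
import Data.Nat.Properties as ℕ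
open import Data.Fin as Fin
  using (Fin; Fin′; toℕ; inject; inject₁; inject≤; fromℕ<; _↑ʳ_; punchIn; punchOut)
open import Data.Fin.Properties
  using ( any?; _≟_; _<?_; ¬Fin0; <-cmp; <⇒≢; <-irrefl; <-trans; ≤∧≢⇒<; ¬∀⟶∃¬-smallest; +↔⊎
        ; toℕ-injective; toℕ<n; toℕ-inject; toℕ-inject₁; toℕ-inject≤; toℕ-↑ʳ; toℕ-fromℕ<
        ; fromℕ<-injective; injective⇒≤
        ; punchOut-injective; punchIn-punchOut; punchInᵢ≢i; punchIn-injective )
open import Data.Fin.Permutation using (_⟨$⟩ˡ_; flip; inverseʳ)
open import Data.Product using (∃; _,_)
open import Data.Sum using (_⊎_; inj₁; inj₂; [_,_])
open import Data.Vec.Functional using (_∷_)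
open import Function using (_∘_)
open import Function.Bundles using (Equivalence; Injection; mk⇔)
open import Function.Definitions using (Injective)
open import Function.Properties.Inverse using (Inverse⇒Injection)
import Function.Properties.Equivalence as ⇔
open import Relation.Binary.Core using (_Preserves_⟶_)
open import Relation.Binary.Definitions using (tri<; tri≈; tri>)
open import Relation.Binary.PropositionalEquality using (_≢_; refl; sym; trans; cong; subst; subst₂)
open import Relation.Nullary using (¬_; Dec; yes; no; does; contradiction)
open import Relation.Unary using (Pred)

Increasing : ∀ {m n} → (Fin m → Fin n) → Set
Increasing ι = ι Preserves Fin._<_ ⟶ Fin._<_

increasing⇒injective : ∀ {m n} {ι : Fin m → Fin n} → Increasing ι → Injective _≡_ _≡_ ι
increasing⇒injective ι-inc {a} {b} ιa≡ιb with <-cmp a b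
... | tri< a<b _ _ = contradiction ιa≡ιb (<⇒≢ (ι-inc a<b))
... | tri≈ _ a≡b _ = a≡b
... | tri> _ _ b<a = contradiction (sym ιa≡ιb) (<⇒≢ (ι-inc b<a))

increasing⇒≤ : ∀ {m n} {ι : Fin m → Fin n} → Increasing ι → ∀ a → toℕ a ≤ toℕ (ι a)
increasing⇒≤ ι-inc Fin.zero = z≤n
increasing⇒≤ {ι = ι} ι-inc (Fin.suc a) =
  ℕ.≤-<-trans (increasing⇒≤ ι∘inject₁-inc a)
              (ι-inc (subst (_< suc (toℕ a)) (sym (toℕ-inject₁ a)) ℕ.≤-refl))
  where
  ι∘inject₁-inc : Increasing (ι ∘ inject₁)
  ι∘inject₁-inc {a} {b} a<b = ι-inc (subst₂ _<_ (sym (toℕ-inject₁ a)) (sym (toℕ-inject₁ b)) a<b)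

injective-below⇒≤ : ∀ {m n v} (f : Fin m → Fin n) →
  Injective _≡_ _≡_ f → (∀ x → toℕ (f x) < v) → m ≤ v
injective-below⇒≤ f f-inj f<v =
  injective⇒≤ {f = λ x → fromℕ< (f<v x)}
    (f-inj ∘ toℕ-injective ∘ fromℕ<-injective _ _ (f<v _) (f<v _))

inject-< : ∀ {n} {i : Fin n} (j : Fin′ i) → inject j Fin.< i
inject-< {i = i} j = subst (_< toℕ i) (sym (toℕ-inject j)) (toℕ<n j)

inject-injective : ∀ {n} {i : Fin n} → Injective _≡_ _≡_ (inject {i = i})
inject-injective {x = j} {k} eq =
  toℕ-injective (trans (sym (toℕ-inject j)) (trans (cong toℕ eq) (toℕ-inject k)))

module _ {m n} (e : Fin m → Fin (suc n)) (0∉e : ∀ x → Fin.zero ≢ e x) where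

  decrement : Fin m → Fin n
  decrement x = punchOut (0∉e x)

  suc-decrement : ∀ x → Fin.suc (decrement x) ≡ e x
  suc-decrement x = punchIn-punchOut (0∉e x)

  decrement-injective : Injective _≡_ _≡_ e → Injective _≡_ _≡_ decrement
  decrement-injective e-inj eq = e-inj (punchOut-injective (0∉e _) (0∉e _) eq)

-- Induction on n: if 0 lies in the image of e it becomes ι 0; the rest of the image, shifted down by
-- one, is enumerated recursively.
increasing-enumeration : ∀ {m n p} (P : Pred (Fin n) p) (e : Fin m → Fin n) →
  Injective _≡_ _≡_ e → (∀ x → P (e x)) →
  ∃ λ (ι : Fin m → Fin n) → Increasing ι × (∀ a → P (ι a))
increasing-enumeration {zero}          P e e-inj Pe = (λ ()) , (λ { {()} }) , (λ ())
increasing-enumeration {suc m} {zero}  P e e-inj Pe = contradiction (e Fin.zero) ¬Fin0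
increasing-enumeration {suc m} {suc n} P e e-inj Pe with any? (λ x → Fin.zero ≟ e x)
... | no 0∉im-e
  with increasing-enumeration (P ∘ Fin.suc) (decrement e 0∉e) (decrement-injective e 0∉e e-inj)
         (λ x → subst P (sym (suc-decrement e 0∉e x)) (Pe x))
  where
  0∉e : ∀ x → Fin.zero ≢ e x
  0∉e x 0≡ex = 0∉im-e (x , 0≡ex)
...  | ι , ι-inc , Pι = Fin.suc ∘ ι , s≤s ∘ ι-inc , Pι
increasing-enumeration {suc m} {suc n} P e e-inj Pe | yes (x , 0≡ex)
  with increasing-enumeration (P ∘ Fin.suc) (decrement e′ 0∉e′) (decrement-injective e′ 0∉e′ e′-inj)
         (λ y → subst P (sym (suc-decrement e′ 0∉e′ y)) (Pe (punchIn x y)))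
  where
  e′ : Fin m → Fin (suc n)
  e′ = e ∘ punchIn x
  0∉e′ : ∀ y → Fin.zero ≢ e′ y
  0∉e′ y 0≡e′y = punchInᵢ≢i x y (e-inj (trans (sym 0≡e′y) 0≡ex))
  e′-inj : Injective _≡_ _≡_ e′
  e′-inj eq = punchIn-injective x _ _ (e-inj eq)
...  | ι , ι-inc , Pι = Fin.zero ∷ Fin.suc ∘ ι , cons-inc , cons-P
  where
  cons-inc : Increasing (Fin.zero ∷ Fin.suc ∘ ι)
  cons-inc {Fin.zero}  {Fin.suc b} _         = s≤s z≤n
  cons-inc {Fin.suc a} {Fin.suc b} (s≤s a<b) = s≤s (ι-inc a<b)
  cons-P : ∀ a → P ((Fin.zero ∷ Fin.suc ∘ ι) a)
  cons-P Fin.zero    = subst P (sym 0≡ex) (Pe x)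
  cons-P (Fin.suc a) = Pι a

module _ {n} (π : Permutation′ n) where

  private
    π-injective : Injective _≡_ _≡_ (π ⟨$⟩ʳ_)
    π-injective = Injection.injective (Inverse⇒Injection π)

    π⁻¹-injective : Injective _≡_ _≡_ (π ⟨$⟩ˡ_)
    π⁻¹-injective = Injection.injective (Inverse⇒Injection (flip π))

  contains-Q : ∀ {k′} (i : Fin n) (τ : Fin k′ → Fin n) → Increasing τ →
    (∀ a → i Fin.< τ a) → (∀ a → π ⟨$⟩ʳ τ a Fin.< π ⟨$⟩ʳ i) → Contains π (Q (suc k′))
  contains-Q {k′} i τ τ-inc i<τ τ-below = i ∷ τ , ι-inc , ι-Q
    where
    ι-inc : ∀ a b → a Fin.< b → (i ∷ τ) a Fin.< (i ∷ τ) b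
    ι-inc Fin.zero    (Fin.suc b) _         = i<τ b
    ι-inc (Fin.suc a) (Fin.suc b) (s≤s a<b) = τ-inc a<b
    ι-Q : ∀ a b → POP._≺_ (Q (suc k′)) a b → π ⟨$⟩ʳ (i ∷ τ) a Fin.< π ⟨$⟩ʳ (i ∷ τ) b
    ι-Q (Fin.suc a) Fin.zero    _            = τ-below a
    ι-Q Fin.zero    Fin.zero    (_ , s≤s ())
    ι-Q _           (Fin.suc _) (() , _)

  enumerate-below : ∀ (v : Fin n) →
    ∃ λ (σ : Fin (toℕ v) → Fin n) → Increasing σ × (∀ a → π ⟨$⟩ʳ σ a Fin.< v)
  enumerate-below v = increasing-enumeration (λ j → π ⟨$⟩ʳ j Fin.< v) (λ y → π ⟨$⟩ˡ inject y)
    (inject-injective ∘ π⁻¹-injective) (λ y → subst (Fin._< v) (sym (inverseʳ π)) (inject-< y))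

  -- The entries below π i of rank toℕ i + a (a < k′) lie right of i.
  large-entry⇒contains-Q : ∀ k′ (i : Fin n) →
    toℕ i + k′ ≤ toℕ (π ⟨$⟩ʳ i) → Contains π (Q (suc k′))
  large-entry⇒contains-Q k′ i i+k′≤πi with enumerate-below (π ⟨$⟩ʳ i)
  ... | σ , σ-inc , σ-below =
    contains-Q i (σ ∘ shift) (σ-inc ∘ shift-inc) i<σ∘shift (σ-below ∘ shift)
    where
    shift : Fin k′ → Fin (toℕ (π ⟨$⟩ʳ i))
    shift a = inject≤ (toℕ i ↑ʳ a) i+k′≤πi
    toℕ-shift : ∀ a → toℕ (shift a) ≡ toℕ i + toℕ a
    toℕ-shift a = trans (toℕ-inject≤ (toℕ i ↑ʳ a) i+k′≤πi) (toℕ-↑ʳ (toℕ i) a)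
    shift-inc : Increasing shift
    shift-inc {a} {b} a<b =
      subst₂ _<_ (sym (toℕ-shift a)) (sym (toℕ-shift b)) (ℕ.+-monoʳ-< (toℕ i) a<b)
    i<σ∘shift : ∀ a → i Fin.< σ (shift a)
    i<σ∘shift a = ≤∧≢⇒<
      (ℕ.≤-trans (ℕ.m≤m+n (toℕ i) (toℕ a))
                 (subst (_≤ toℕ (σ (shift a))) (toℕ-shift a) (increasing⇒≤ σ-inc (shift a))))
      (λ i≡σa → <-irrefl (cong (π ⟨$⟩ʳ_) (sym i≡σa)) (σ-below (shift a)))

  prefix-and-tail-below⇒≤ : ∀ {k′} (m v : Fin n) (τ : Fin k′ → Fin n) →
    Increasing τ → (∀ a → m Fin.< τ a) →
    (∀ (j : Fin′ m) → π ⟨$⟩ʳ inject j Fin.< v) → (∀ a → π ⟨$⟩ʳ τ a Fin.< v) → toℕ m + k′ ≤ toℕ v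
  prefix-and-tail-below⇒≤ {k′} m v τ τ-inc m<τ prefix-below τ-below =
    injective-below⇒≤ ((π ⟨$⟩ʳ_) ∘ positions ∘ splitAt)
      (splitAt-injective ∘ positions-injective ∘ π-injective) (below ∘ splitAt)
    where
    splitAt : Fin (toℕ m + k′) → Fin (toℕ m) ⊎ Fin k′
    splitAt = Fin.splitAt (toℕ m)
    splitAt-injective : Injective _≡_ _≡_ splitAt
    splitAt-injective = Injection.injective (Inverse⇒Injection +↔⊎)
    positions : Fin (toℕ m) ⊎ Fin k′ → Fin n
    positions = [ inject , τ ]
    positions-injective : Injective _≡_ _≡_ positions
    positions-injective {inj₁ j} {inj₁ j′} eq = cong inj₁ (inject-injective eq)
    positions-injective {inj₁ j} {inj₂ a}  eq = contradiction eq (<⇒≢ (<-trans (inject-< j) (m<τ a)))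
    positions-injective {inj₂ a} {inj₁ j}  eq = contradiction (sym eq) (<⇒≢ (<-trans (inject-< j) (m<τ a)))
    positions-injective {inj₂ a} {inj₂ b}  eq = cong inj₂ (increasing⇒injective τ-inc eq)
    below : ∀ s → π ⟨$⟩ʳ positions s Fin.< v
    below (inj₁ j) = prefix-below j
    below (inj₂ a) = τ-below a

  bounded⇒¬tail-below : ∀ {k′} → (∀ j → toℕ (π ⟨$⟩ʳ j) < toℕ j + k′) →
    (i : Fin n) (τ : Fin k′ → Fin n) → Increasing τ → (∀ a → i Fin.< τ a) →
    ¬ (∀ a → π ⟨$⟩ʳ τ a Fin.< π ⟨$⟩ʳ i)
  bounded⇒¬tail-below {k′} bounded i τ τ-inc i<τ τ-below
    with ¬∀⟶∃¬-smallest n (λ j → π ⟨$⟩ʳ j Fin.< π ⟨$⟩ʳ i) (λ j → π ⟨$⟩ʳ j <? π ⟨$⟩ʳ i)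
           (λ all-below → <-irrefl refl (all-below i))
  ... | m , πm≮πi , left-of-m-below = ℕ.<⇒≱ (bounded m) (ℕ.≤-trans m+k′≤πi (ℕ.≮⇒≥ πm≮πi))
    where
    m≤i : m Fin.≤ i
    m≤i = ℕ.≮⇒≥ λ i<m → <-irrefl refl
      (subst (λ j → π ⟨$⟩ʳ j Fin.< π ⟨$⟩ʳ i) (toℕ-injective (trans (toℕ-inject _) (toℕ-fromℕ< i<m)))
        (left-of-m-below (fromℕ< i<m)))
    m<τ : ∀ a → m Fin.< τ a
    m<τ a = ℕ.≤-<-trans m≤i (i<τ a)
    m+k′≤πi : toℕ m + k′ ≤ toℕ (π ⟨$⟩ʳ i)
    m+k′≤πi = prefix-and-tail-below⇒≤ m (π ⟨$⟩ʳ i) τ τ-inc m<τ left-of-m-below τ-below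

  avoids-Q⇔bounded : ∀ k′ → Avoids π (Q (suc k′)) ⇔ (∀ i → toℕ (π ⟨$⟩ʳ i) < toℕ i + k′)
  avoids-Q⇔bounded k′ = mk⇔
    (λ avoids i → ℕ.≰⇒> (avoids ∘ large-entry⇒contains-Q k′ i))
    (λ { bounded (ι , ι-inc , ι-Q) → bounded⇒¬tail-below bounded (ι Fin.zero) (ι ∘ Fin.suc)
           (λ a<b → ι-inc _ _ (s≤s a<b)) (λ a → ι-inc Fin.zero (Fin.suc a) (s≤s z≤n))
           (λ a → ι-Q (Fin.suc a) Fin.zero (refl , s≤s (s≤s z≤n))) })

does≡true⇔ : ∀ {a} {A : Set a} (a? : Dec A) → does a? ≡ true ⇔ A
does≡true⇔ (yes a) = mk⇔ (λ _ → a) (λ _ → refl)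
does≡true⇔ (no ¬a) = mk⇔ (λ ()) (λ a → contradiction a ¬a)

suc+2≤suc+suc⇔< : ∀ m t k → suc m + 2 ≤ suc t + suc k ⇔ m < t + k
suc+2≤suc+suc⇔< m t k rewrite ℕ.+-comm m 2 | ℕ.+-suc t k = mk⇔ (s≤s⁻¹ ∘ s≤s⁻¹) (s≤s ∘ s≤s)

∀-cong : ∀ {a b c} {I : Set a} {P : I → Set b} {R : I → Set c} →
  (∀ i → P i ⇔ R i) → (∀ i → P i) ⇔ (∀ i → R i)
∀-cong P⇔R = mk⇔ (λ p i → Equivalence.to (P⇔R i) (p i)) (λ r i → Equivalence.from (P⇔R i) (r i))

mainTheorem3 : (k n : ℕ) → 1 ≤ k → 1 ≤ n → (π : Permutation′ n) →
    (Avoids π (Q k) ⇔ (∀ i → A k n i (π ⟨$⟩ʳ i) ≡ true))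
      × (Avoids π (Q k) ⇔ (∀ i → ⟦ π ⟨$⟩ʳ i ⟧ + 2 ≤ ⟦ i ⟧ + k))
mainTheorem3 zero    _ () _ _
mainTheorem3 (suc k′) n _  _ π =
  ⇔.trans avoids⇔shifted-bound (∀-cong λ i → ⇔.sym (does≡true⇔ (⟦ π ⟨$⟩ʳ i ⟧ + 2 ≤? ⟦ i ⟧ + suc k′))) ,
  avoids⇔shifted-bound
  where
  avoids⇔shifted-bound : Avoids π (Q (suc k′)) ⇔ (∀ i → ⟦ π ⟨$⟩ʳ i ⟧ + 2 ≤ ⟦ i ⟧ + suc k′)
  avoids⇔shifted-bound = ⇔.trans (avoids-Q⇔bounded π k′)
    (∀-cong λ i → ⇔.sym (suc+2≤suc+suc⇔< (toℕ (π ⟨$⟩ʳ i)) (toℕ i) k′))
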